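{- Let $Q \in \mathbb{Z}[X]$ with $Q(0)=1$ such that $Q \bmod 4$ is a perfect square in $(\mathbb{Z}/4\mathbb{Z})[X]$. Then the Taylor expansion of $\sqrt{Q(X)}$ at $X=0$ (with constant term $1$) has integer coefficients: $\sqrt{Q(X)} \in 1 + X\mathbb{Z}[[X]]$. In particular, for every $P \in \mathbb{Z}[X]$ with $P(0)=1$, writing $P(X)=\prod_{i=1}^n(1-\beta_iX)$ over $\mathbb{C}$ and $P_m(X):=\prod_{i=1}^n(1-\beta_i^mX)$, one has $\sqrt{P_2(X)P_4(X)} \in \mathbb{Z}[[X]]$. -}

module Defs where

open import Data.Nat using (ℕ; zero; suc; _∸_; _*_)
open import Data.Integer using (ℤ; +_; -_) renaming (_+_ to _+ℤ_; _*_ to _*ℤ_; _-_ to _-ℤ_)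
open import Data.Integer.Divisibility using (_∣_)
open import Data.List using (List; []; _∷_)
open import Data.Product using (∃; _×_)
open import Relation.Binary.PropositionalEquality using (_≡_)

Series : Set
Series = ℕ → ℤ

-- Polynomials over ℤ: coefficient lists, lowest degree first.
Poly : Set
Poly = List ℤ

coeff : Poly → Series
coeff []       n       = + 0
coeff (a ∷ p)  zero    = a
coeff (a ∷ p)  (suc n) = coeff p n

sumTo : (ℕ → ℤ) → ℕ → ℤ
sumTo f zero    = f zero
sumTo f (suc n) = sumTo f n +ℤ f (suc n)

_⊛_ : Series → Series → Series
(a ⊛ b) n = sumTo (λ i → a i *ℤ b (n ∸ i)) n

_≡[mod_]_ : ℤ → ℤ → ℤ → Set
a ≡[mod m ] b = m ∣ (a -ℤ b)

-- "Q mod 4 is a perfect square in (ℤ/4ℤ)[X]": some R ∈ ℤ[X] (any lift of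
-- a polynomial over ℤ/4ℤ) has R² ≡ Q coefficientwise mod 4.
IsSquareMod4 : Poly → Set
IsSquareMod4 Q = ∃ λ (R : Poly) → ∀ n → ((coeff R ⊛ coeff R) n) ≡[mod + 4 ] coeff Q n

-- "√F ∈ 1 + Xℤ[[X]]": the power series square root of F with constant
-- term 1 (unique in ℚ[[X]] when F(0)=1) has integer coefficients, i.e.
-- there is S ∈ ℤ[[X]] with S(0) = 1 and S² = F.
HasIntegralSqrt : Series → Set
HasIntegralSqrt F = ∃ λ (S : Series) → (S 0 ≡ + 1) × (∀ n → (S ⊛ S) n ≡ F n)

negX : Series → Series
negX a zero          = a zero
negX a (suc zero)    = - a (suc zero)
negX a (suc (suc n)) = negX (λ k → a (suc (suc k))) n

-- Graeffe step: if F(X) = ∏(1 - β_i X) then F(X)F(-X) = ∏(1 - β_i² X²),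
-- so graeffe F = ∏(1 - β_i² X), i.e. the coefficient of X^n is that of
-- X^{2n} in F(X)F(-X).
graeffe : Series → Series
graeffe F n = (F ⊛ negX F) (2 * n)

P₂ : Poly → Series
P₂ P = graeffe (coeff P)

P₄ : Poly → Series
P₄ P = graeffe (P₂ P)

module Submission where

-- Q(0) = 1 lets one solve S² = Q for the coefficients of S one at a time: if S has degree
-- ≤ n, S(0) = 1 and S² agrees with Q up to degree n, then S + c X^{n+1} agrees up to
-- degree n+1 exactly when 2c is the coefficient of X^{n+1} still missing. That coefficient
-- is even: A ≡ B (mod 2) implies A² ≡ B² (mod 4), so if R² ≡ Q (mod 4) then S stays
-- ≡ R (mod 2) by induction, and the missing coefficient is ≡ 2 R_{n+1} (mod 4).
-- For the second claim, P₂(X²) = P(X) P(-X) ≡ P(X)² ≡ P(X²) (mod 2), so P₂ ≡ P (mod 2);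
-- squaring again gives P₄ ≡ P₂ (mod 4), and P₂ P₄ ≡ P₂² (mod 4) is a square mod 4.

open import Defs
open import Data.Nat as ℕ using (ℕ; zero; suc; _∸_; _≤_; _<_; z≤n; s≤s)
import Data.Nat.Properties as ℕ
open import Data.Integer as ℤ using (ℤ; +_; -_; _+_; _*_; _-_; 0ℤ; 1ℤ; -1ℤ; _^_)
import Data.Integer.Properties as ℤ
import Data.Integer.DivMod as DivMod
open import Data.Integer.Divisibility.Signed
  using (_∣_; divides; _∣?_; ∣ᵤ⇒∣; ∣-trans; ∣m∣n⇒∣m+n; ∣m⇒∣-m; ∣m⇒∣m*n; ∣n⇒∣m*n; *-cancelʳ-∣)
open import Data.Integer.Tactic.RingSolver using (solve-∀)
open import Data.Product using (_×_; _,_)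
open import Data.Sum using (_⊎_; inj₁; inj₂)
open import Function using (_∘_; const)
open import Level using (0ℓ)
open import Relation.Binary.Bundles using (Setoid)
open import Relation.Binary.PropositionalEquality
  using (_≡_; _≢_; refl; sym; trans; cong; cong₂; subst; subst₂; module ≡-Reasoning)
open import Relation.Nullary using (yes; no; contradiction)

-- Defs' _≡[mod_]_ with signed divisibility, wrapped in a record so that a and b are inferable.
infix 4 _≈[_]_
record _≈[_]_ (a m b : ℤ) : Set where
  constructor ≈-intro
  field ∣difference : m ∣ a - b
open _≈[_]_

module _ {m : ℤ} where

  ≈-by : ∀ {a b} x → x ≡ a - b → m ∣ x → a ≈[ m ] b
  ≈-by x eq m∣x = ≈-intro (subst (m ∣_) eq m∣x)

  ≈-refl : ∀ {a} → a ≈[ m ] a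
  ≈-refl {a} = ≈-intro (divides 0ℤ (ℤ.+-inverseʳ a))

  ≈-reflexive : ∀ {a b} → a ≡ b → a ≈[ m ] b
  ≈-reflexive refl = ≈-refl

  ≈-sym : ∀ {a b} → a ≈[ m ] b → b ≈[ m ] a
  ≈-sym {a} {b} (≈-intro p) = ≈-by _ (eq a b) (∣m⇒∣-m p)
    where eq : ∀ a b → - (a - b) ≡ b - a
          eq = solve-∀

  ≈-trans : ∀ {a b c} → a ≈[ m ] b → b ≈[ m ] c → a ≈[ m ] c
  ≈-trans {a} {b} {c} (≈-intro p) (≈-intro q) = ≈-by _ (eq a b c) (∣m∣n⇒∣m+n p q)
    where eq : ∀ a b c → (a - b) + (b - c) ≡ a - c
          eq = solve-∀

  +-cong-≈ : ∀ {a b c d} → a ≈[ m ] b → c ≈[ m ] d → a + c ≈[ m ] b + d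
  +-cong-≈ {a} {b} {c} {d} (≈-intro p) (≈-intro q) = ≈-by _ (eq a b c d) (∣m∣n⇒∣m+n p q)
    where eq : ∀ a b c d → (a - b) + (c - d) ≡ (a + c) - (b + d)
          eq = solve-∀

  *-cong-≈ : ∀ {a b c d} → a ≈[ m ] b → c ≈[ m ] d → a * c ≈[ m ] b * d
  *-cong-≈ {a} {b} {c} {d} (≈-intro p) (≈-intro q) =
    ≈-by _ (eq a b c d) (∣m∣n⇒∣m+n (∣m⇒∣m*n c p) (∣n⇒∣m*n b q))
    where eq : ∀ a b c d → (a - b) * c + b * (c - d) ≡ a * c - b * d
          eq = solve-∀

  ≈-setoid : Setoid 0ℓ 0ℓ
  ≈-setoid = record
    { Carrier = ℤ ; _≈_ = _≈[ m ]_
    ; isEquivalence = record { refl = ≈-refl ; sym = ≈-sym ; trans = ≈-trans } }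

  *-≈0 : ∀ q → q * m ≈[ m ] 0ℤ
  *-≈0 q = ≈-intro (divides q (ℤ.+-identityʳ (q * m)))

  a≈b+c⇒a-b≈c : ∀ {a b c} → a ≈[ m ] b + c → a - b ≈[ m ] c
  a≈b+c⇒a-b≈c {a} {b} {c} (≈-intro p) = ≈-by _ (eq a b c) p
    where eq : ∀ a b c → a - (b + c) ≡ (a - b) - c
          eq = solve-∀

  ≈0⇒∣ : ∀ {a} → a ≈[ m ] 0ℤ → m ∣ a
  ≈0⇒∣ {a} (≈-intro p) = subst (m ∣_) (ℤ.+-identityʳ a) p

  *-cancelʳ-≈ : ∀ k .{{_ : ℤ.NonZero k}} {a b} → a * k ≈[ m * k ] b * k → a ≈[ m ] b
  *-cancelʳ-≈ k {a} {b} (≈-intro p) = ≈-intro (*-cancelʳ-∣ k (subst (m * k ∣_) (eq a b k) p))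
    where eq : ∀ a b k → a * k - b * k ≡ (a - b) * k
          eq = solve-∀

≈-divisor : ∀ {k m a b} → k ∣ m → a ≈[ m ] b → a ≈[ k ] b
≈-divisor k∣m (≈-intro p) = ≈-intro (∣-trans k∣m p)

module ≈-Reasoning (m : ℤ) where
  open import Relation.Binary.Reasoning.Setoid (≈-setoid {m}) public

square-≈-mod2 : ∀ x → x * x ≈[ + 2 ] x
square-≈-mod2 x = subst (λ y → y * y ≈[ + 2 ] y) (sym (DivMod.a≡a%ℕn+[a/ℕn]*n x 2))
                        (by-remainder (x DivMod.%ℕ 2) (DivMod.n%ℕd<d x 2))
  where
  q : ℤ
  q = x DivMod./ℕ 2
  by-remainder : ∀ r → r < 2 → (+ r + q * + 2) * (+ r + q * + 2) ≈[ + 2 ] + r + q * + 2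
  by-remainder 0 _ = ≈-by _ (eq₀ q) (divides (q * (q * + 2 - 1ℤ)) refl)
    where eq₀ : ∀ q → q * (q * + 2 - 1ℤ) * + 2 ≡ (+ 0 + q * + 2) * (+ 0 + q * + 2) - (+ 0 + q * + 2)
          eq₀ = solve-∀
  by-remainder 1 _ = ≈-by _ (eq₁ q) (divides (q * (1ℤ + q * + 2)) refl)
    where eq₁ : ∀ q → q * (1ℤ + q * + 2) * + 2 ≡ (1ℤ + q * + 2) * (1ℤ + q * + 2) - (1ℤ + q * + 2)
          eq₁ = solve-∀
  by-remainder (suc (suc _)) (s≤s (s≤s ()))

double-≈-mod2 : ∀ x → x + x ≈[ + 2 ] 0ℤ
double-≈-mod2 x = ≈-by (x * + 2) (eq x) (divides x refl)
  where eq : ∀ x → x * + 2 ≡ (x + x) - 0ℤ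
        eq = solve-∀

odd*-≈-mod2 : ∀ {σ} a → σ ≈[ + 2 ] 1ℤ → σ * a ≈[ + 2 ] a
odd*-≈-mod2 a σ≈1 = ≈-trans (*-cong-≈ σ≈1 ≈-refl) (≈-reflexive (ℤ.*-identityˡ a))

even*even : ∀ {x y} → + 2 ∣ x → + 2 ∣ y → + 4 ∣ x * y
even*even (divides p refl) (divides q refl) = divides (p * q) (eq p q)
  where eq : ∀ p q → (p * + 2) * (q * + 2) ≡ (p * q) * + 4
        eq = solve-∀

-- Junk value 0 on odd arguments.
half : ℤ → ℤ
half x with + 2 ∣? x
... | yes (divides q _) = q
... | no _              = 0ℤ

half-* : ∀ {x} → + 2 ∣ x → half x * + 2 ≡ x
half-* {x} 2∣x with + 2 ∣? x
... | yes (divides q eq) = sym eq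
... | no 2∤x             = contradiction 2∣x 2∤x

≤-suc-cases : ∀ {k n} → k ≤ suc n → k ≤ n ⊎ k ≡ suc n
≤-suc-cases k≤1+n with ℕ.m≤n⇒m<n∨m≡n k≤1+n
... | inj₁ k<1+n = inj₁ (ℕ.≤-pred k<1+n)
... | inj₂ k≡1+n = inj₂ k≡1+n

sumTo-cong : ∀ {f g} n → (∀ i → i ≤ n → f i ≡ g i) → sumTo f n ≡ sumTo g n
sumTo-cong zero    f≡g = f≡g 0 z≤n
sumTo-cong (suc n) f≡g =
  cong₂ _+_ (sumTo-cong n (λ i i≤n → f≡g i (ℕ.m≤n⇒m≤1+n i≤n))) (f≡g (suc n) ℕ.≤-refl)

sumTo-cong-≈ : ∀ {m f g} n → (∀ i → i ≤ n → f i ≈[ m ] g i) → sumTo f n ≈[ m ] sumTo g n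
sumTo-cong-≈ zero    f≈g = f≈g 0 z≤n
sumTo-cong-≈ (suc n) f≈g =
  +-cong-≈ (sumTo-cong-≈ n (λ i i≤n → f≈g i (ℕ.m≤n⇒m≤1+n i≤n))) (f≈g (suc n) ℕ.≤-refl)

sumTo-∣ : ∀ {m f} n → (∀ i → i ≤ n → m ∣ f i) → m ∣ sumTo f n
sumTo-∣ zero    m∣f = m∣f 0 z≤n
sumTo-∣ (suc n) m∣f =
  ∣m∣n⇒∣m+n (sumTo-∣ n (λ i i≤n → m∣f i (ℕ.m≤n⇒m≤1+n i≤n))) (m∣f (suc n) ℕ.≤-refl)

sumTo-suc : ∀ f n → sumTo f (suc n) ≡ f 0 + sumTo (f ∘ suc) n
sumTo-suc f zero    = refl
sumTo-suc f (suc n) = trans (cong (_+ f (suc (suc n))) (sumTo-suc f n)) (ℤ.+-assoc (f 0) _ _)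

sumTo-reverse : ∀ f n → sumTo f n ≡ sumTo (λ i → f (n ∸ i)) n
sumTo-reverse f zero    = refl
sumTo-reverse f (suc n) = begin
  sumTo f n + f (suc n)                          ≡⟨ cong (_+ f (suc n)) (sumTo-reverse f n) ⟩
  sumTo (λ i → f (n ∸ i)) n + f (suc n)          ≡⟨ ℤ.+-comm _ (f (suc n)) ⟩
  f (suc n) + sumTo (λ i → f (n ∸ i)) n          ≡⟨ sumTo-suc (λ i → f (suc n ∸ i)) n ⟨
  sumTo (λ i → f (suc n ∸ i)) (suc n)            ∎
  where open ≡-Reasoning

sumTo-+ : ∀ f g n → sumTo (λ i → f i + g i) n ≡ sumTo f n + sumTo g n
sumTo-+ f g zero    = refl
sumTo-+ f g (suc n) = trans (cong (_+ (f (suc n) + g (suc n))) (sumTo-+ f g n))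
                            (eq (sumTo f n) (sumTo g n) (f (suc n)) (g (suc n)))
  where eq : ∀ a b c d → (a + b) + (c + d) ≡ (a + c) + (b + d)
        eq = solve-∀

sumTo-sub : ∀ f g n → sumTo (λ i → f i - g i) n ≡ sumTo f n - sumTo g n
sumTo-sub f g zero    = refl
sumTo-sub f g (suc n) = trans (cong (_+ (f (suc n) - g (suc n))) (sumTo-sub f g n))
                              (eq (sumTo f n) (sumTo g n) (f (suc n)) (g (suc n)))
  where eq : ∀ a b c d → (a - b) + (c - d) ≡ (a + c) - (b + d)
        eq = solve-∀

_⊕_ : Series → Series → Series
(A ⊕ B) k = A k + B k

_∙_ : Series → Series → Series
(A ∙ B) k = A k * B k

_·X^_ : ℤ → ℕ → Series
(c ·X^ zero)  zero    = c
(c ·X^ zero)  (suc k) = 0ℤ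
(c ·X^ suc m) zero    = 0ℤ
(c ·X^ suc m) (suc k) = (c ·X^ m) k

·X^-≡ : ∀ c m → (c ·X^ m) m ≡ c
·X^-≡ c zero    = refl
·X^-≡ c (suc m) = ·X^-≡ c m

·X^-≢ : ∀ c {m k} → k ≢ m → (c ·X^ m) k ≡ 0ℤ
·X^-≢ c {zero}  {zero}  k≢m = contradiction refl k≢m
·X^-≢ c {zero}  {suc k} _   = refl
·X^-≢ c {suc m} {zero}  _   = refl
·X^-≢ c {suc m} {suc k} k≢m = ·X^-≢ c (k≢m ∘ cong suc)

⊛-comm : ∀ A B k → (A ⊛ B) k ≡ (B ⊛ A) k
⊛-comm A B k = trans (sumTo-reverse _ k) (sumTo-cong k λ i i≤k →
  trans (cong (λ j → A (k ∸ i) * B j) (ℕ.m∸[m∸n]≡n i≤k)) (ℤ.*-comm (A (k ∸ i)) (B i)))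

⊛-cong-≤ : ∀ {A A′ B B′} k → (∀ i → i ≤ k → A i ≡ A′ i) → (∀ i → i ≤ k → B i ≡ B′ i) →
           (A ⊛ B) k ≡ (A′ ⊛ B′) k
⊛-cong-≤ k A≡ B≡ = sumTo-cong k λ i i≤k → cong₂ _*_ (A≡ i i≤k) (B≡ (k ∸ i) (ℕ.m∸n≤m k i))

⊛-cong-≈ : ∀ {m A A′ B B′} k → (∀ i → i ≤ k → A i ≈[ m ] A′ i) → (∀ i → i ≤ k → B i ≈[ m ] B′ i) →
           (A ⊛ B) k ≈[ m ] (A′ ⊛ B′) k
⊛-cong-≈ k A≈ B≈ = sumTo-cong-≈ k λ i i≤k → *-cong-≈ (A≈ i i≤k) (B≈ (k ∸ i) (ℕ.m∸n≤m k i))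

⊛-distribʳ-⊕ : ∀ A B C k → ((A ⊕ B) ⊛ C) k ≡ (A ⊛ C) k + (B ⊛ C) k
⊛-distribʳ-⊕ A B C k =
  trans (sumTo-cong k λ i _ → ℤ.*-distribʳ-+ (C (k ∸ i)) (A i) (B i)) (sumTo-+ _ _ k)

·X^-⊛ : ∀ c m B → ((c ·X^ m) ⊛ B) m ≡ c * B 0
·X^-⊛ c zero    B = refl
·X^-⊛ c (suc m) B = trans (sumTo-suc _ m) (trans (ℤ.+-identityˡ _) (·X^-⊛ c m B))

⊛-square-⊕·X^ : ∀ T c n → let V = T ⊕ (c ·X^ suc n) in
                (V ⊛ V) (suc n) ≡ (T ⊛ T) (suc n) + (c * T 0 + c * T 0)
⊛-square-⊕·X^ T c n = begin
  (V ⊛ V) m                             ≡⟨ ⊛-distribʳ-⊕ T M V m ⟩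
  (T ⊛ V) m + (M ⊛ V) m                 ≡⟨ cong₂ _+_ (⊛-comm T V m) (·X^-⊛ c m V) ⟩
  (V ⊛ T) m + c * (T 0 + 0ℤ)            ≡⟨ cong₂ _+_ (⊛-distribʳ-⊕ T M T m) (cong (c *_) (ℤ.+-identityʳ (T 0))) ⟩
  ((T ⊛ T) m + (M ⊛ T) m) + c * T 0     ≡⟨ cong (λ x → ((T ⊛ T) m + x) + c * T 0) (·X^-⊛ c m T) ⟩
  ((T ⊛ T) m + c * T 0) + c * T 0       ≡⟨ ℤ.+-assoc ((T ⊛ T) m) (c * T 0) (c * T 0) ⟩
  (T ⊛ T) m + (c * T 0 + c * T 0)       ∎
  where
  open ≡-Reasoning
  m : ℕ
  m = suc n
  M V : Series
  M = c ·X^ m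
  V = T ⊕ M

-- Pairing the i-th and (k-i)-th terms: with D = A - B even, the difference is
-- Σ D_i (σ_{k-i} A_{k-i} + σ_i B_{k-i}), and the bracket is ≡ A_{k-i} + B_{k-i} ≡ 0 (mod 2).
⊛-weighted-square-≈ : ∀ σ → (∀ j → σ j ≈[ + 2 ] 1ℤ) →
                      ∀ A B k → (∀ i → i ≤ k → A i ≈[ + 2 ] B i) →
                      (A ⊛ (σ ∙ A)) k ≈[ + 4 ] (B ⊛ (σ ∙ B)) k
⊛-weighted-square-≈ σ σ-odd A B k A≈B = ≈-by (sumTo Z k) (sym difference) (sumTo-∣ k 4∣Z)
  where
  D X Y Y′ Z : ℕ → ℤ
  D i  = A i - B i
  X i  = D i * (σ (k ∸ i) * A (k ∸ i))
  Y i  = B i * (σ (k ∸ i) * D (k ∸ i))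
  Y′ i = B (k ∸ i) * (σ i * D i)
  Z i  = D i * (σ (k ∸ i) * A (k ∸ i) + σ i * B (k ∸ i))

  split : ∀ a b s a′ b′ → a * (s * a′) - b * (s * b′) ≡ (a - b) * (s * a′) + b * (s * (a′ - b′))
  split = solve-∀
  merge : ∀ d s a b t → d * (s * a) + b * (t * d) ≡ d * (s * a + t * b)
  merge = solve-∀

  difference : (A ⊛ (σ ∙ A)) k - (B ⊛ (σ ∙ B)) k ≡ sumTo Z k
  difference = begin
    (A ⊛ (σ ∙ A)) k - (B ⊛ (σ ∙ B)) k
      ≡⟨ sumTo-sub _ _ k ⟨
    sumTo (λ i → A i * (σ (k ∸ i) * A (k ∸ i)) - B i * (σ (k ∸ i) * B (k ∸ i))) k
      ≡⟨ sumTo-cong k (λ i _ → split (A i) (B i) (σ (k ∸ i)) (A (k ∸ i)) (B (k ∸ i))) ⟩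
    sumTo (λ i → X i + Y i) k
      ≡⟨ sumTo-+ X Y k ⟩
    sumTo X k + sumTo Y k
      ≡⟨ cong (λ s → sumTo X k + s) (trans (sumTo-reverse Y k) (sumTo-cong k λ i i≤k →
           cong (λ j → B (k ∸ i) * (σ j * D j)) (ℕ.m∸[m∸n]≡n i≤k))) ⟩
    sumTo X k + sumTo Y′ k
      ≡⟨ sumTo-+ X Y′ k ⟨
    sumTo (λ i → X i + Y′ i) k
      ≡⟨ sumTo-cong k (λ i _ → merge (D i) (σ (k ∸ i)) (A (k ∸ i)) (B (k ∸ i)) (σ i)) ⟩
    sumTo Z k ∎
    where open ≡-Reasoning

  4∣Z : ∀ i → i ≤ k → + 4 ∣ Z i
  4∣Z i i≤k = even*even (∣difference (A≈B i i≤k)) (≈0⇒∣ (begin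
    σ (k ∸ i) * A (k ∸ i) + σ i * B (k ∸ i) ≈⟨ +-cong-≈ (odd*-≈-mod2 _ (σ-odd (k ∸ i))) (odd*-≈-mod2 _ (σ-odd i)) ⟩
    A (k ∸ i) + B (k ∸ i)                   ≈⟨ +-cong-≈ (A≈B (k ∸ i) (ℕ.m∸n≤m k i)) ≈-refl ⟩
    B (k ∸ i) + B (k ∸ i)                   ≈⟨ double-≈-mod2 (B (k ∸ i)) ⟩
    0ℤ                                      ∎))
    where open ≈-Reasoning (+ 2)

⊛-square-≈ : ∀ A B k → (∀ i → i ≤ k → A i ≈[ + 2 ] B i) → (A ⊛ A) k ≈[ + 4 ] (B ⊛ B) k
⊛-square-≈ A B k A≈B = subst₂ _≈[ + 4 ]_ (unweighted A) (unweighted B)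
                                (⊛-weighted-square-≈ (const 1ℤ) (λ _ → ≈-refl) A B k A≈B)
  where unweighted : ∀ A → (A ⊛ (const 1ℤ ∙ A)) k ≡ (A ⊛ A) k
        unweighted A = ⊛-cong-≤ {A = A} k (λ _ _ → refl) (λ j _ → ℤ.*-identityˡ (A j))

⊕·X^-below : ∀ T c n {k} → k ≤ n → (T ⊕ (c ·X^ suc n)) k ≡ T k
⊕·X^-below T c n {k} k≤n =
  trans (cong (λ x → T k + x) (·X^-≢ c (ℕ.<⇒≢ (s≤s k≤n)))) (ℤ.+-identityʳ (T k))

⊕·X^-top : ∀ T c n → T (suc n) ≡ 0ℤ → (T ⊕ (c ·X^ suc n)) (suc n) ≡ c
⊕·X^-top T c n T₁₊ₙ≡0 = trans (cong₂ _+_ T₁₊ₙ≡0 (·X^-≡ c (suc n))) (ℤ.+-identityˡ c)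

module SquareRoot (F : Series) where

  -- Adding c X^{n+1} to approx n (degree ≤ n, constant term 1) raises the coefficient of
  -- X^{n+1} in its square by exactly 2c, so c is half of what is still missing there.
  nextCoeff : Series → ℕ → ℤ
  nextCoeff T n = half (F (suc n) - (T ⊛ T) (suc n))

  approx : ℕ → Series
  approx zero    = 1ℤ ·X^ 0
  approx (suc n) = approx n ⊕ (nextCoeff (approx n) n ·X^ suc n)

  √F : Series
  √F k = approx k k

  approx-> : ∀ {n k} → n < k → approx n k ≡ 0ℤ
  approx-> {zero}  {k} 0<k = ·X^-≢ 1ℤ (ℕ.>⇒≢ 0<k)
  approx-> {suc n} {k} n<k = cong₂ _+_ (approx-> (ℕ.<-trans (ℕ.n<1+n n) n<k)) (·X^-≢ _ (ℕ.>⇒≢ n<k))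

  approx-0 : ∀ n → approx n 0 ≡ 1ℤ
  approx-0 zero    = refl
  approx-0 (suc n) = trans (⊕·X^-below (approx n) (nextCoeff (approx n) n) n z≤n) (approx-0 n)

  approx-≡-√F : ∀ {n k} → k ≤ n → approx n k ≡ √F k
  approx-≡-√F {zero}  z≤n = refl
  approx-≡-√F {suc n} k≤1+n with ≤-suc-cases k≤1+n
  ... | inj₁ k≤n  = trans (⊕·X^-below (approx n) _ n k≤n) (approx-≡-√F k≤n)
  ... | inj₂ refl = refl

  ⊛-square-approx-⊕·X^ : ∀ n c → let V = approx n ⊕ (c ·X^ suc n) in
                         (V ⊛ V) (suc n) ≡ (approx n ⊛ approx n) (suc n) + c * + 2
  ⊛-square-approx-⊕·X^ n c = trans (⊛-square-⊕·X^ (approx n) c n) (trans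
    (cong (λ t → (approx n ⊛ approx n) (suc n) + (c * t + c * t)) (approx-0 n))
    (eq ((approx n ⊛ approx n) (suc n)) c))
    where eq : ∀ s c → s + (c * 1ℤ + c * 1ℤ) ≡ s + c * + 2
          eq = solve-∀

  module _ (F0 : F 0 ≡ 1ℤ) (R : Series) (R²≈F : ∀ n → (R ⊛ R) n ≈[ + 4 ] F n) where

    R0-odd : R 0 ≈[ + 2 ] 1ℤ
    R0-odd = begin
      R 0        ≈⟨ square-≈-mod2 (R 0) ⟨
      R 0 * R 0  ≈⟨ ≈-divisor (divides (+ 2) refl) (R²≈F 0) ⟩
      F 0        ≡⟨ F0 ⟩
      1ℤ         ∎
      where open ≈-Reasoning (+ 2)

    module _ (n : ℕ) (approx≈R : ∀ k → k ≤ n → approx n k ≈[ + 2 ] R k) where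
      private
        T V : Series
        T = approx n
        V = T ⊕ (R (suc n) ·X^ suc n)

        V≈R : ∀ k → k ≤ suc n → V k ≈[ + 2 ] R k
        V≈R k k≤1+n with ≤-suc-cases k≤1+n
        ... | inj₁ k≤n  = ≈-trans (≈-reflexive (⊕·X^-below T _ n k≤n)) (approx≈R k k≤n)
        ... | inj₂ refl = ≈-reflexive (⊕·X^-top T _ n (approx-> (ℕ.n<1+n n)))

      residual-≈ : F (suc n) - (T ⊛ T) (suc n) ≈[ + 4 ] R (suc n) * + 2
      residual-≈ = a≈b+c⇒a-b≈c (begin
        F (suc n)                               ≈⟨ R²≈F (suc n) ⟨
        (R ⊛ R) (suc n)                         ≈⟨ ⊛-square-≈ V R (suc n) V≈R ⟨
        (V ⊛ V) (suc n)                         ≡⟨ ⊛-square-approx-⊕·X^ n (R (suc n)) ⟩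
        (T ⊛ T) (suc n) + R (suc n) * + 2       ∎)
        where open ≈-Reasoning (+ 4)

      residual-even : + 2 ∣ F (suc n) - (T ⊛ T) (suc n)
      residual-even = ≈0⇒∣ (≈-trans (≈-divisor (divides (+ 2) refl) residual-≈) (*-≈0 (R (suc n))))

      nextCoeff-≈ : nextCoeff T n ≈[ + 2 ] R (suc n)
      nextCoeff-≈ = *-cancelʳ-≈ (+ 2)
        (subst (_≈[ + 4 ] R (suc n) * + 2) (sym (half-* residual-even)) residual-≈)

    approx≈R : ∀ n k → k ≤ n → approx n k ≈[ + 2 ] R k
    approx≈R zero    zero    _ = ≈-sym R0-odd
    approx≈R (suc n) k k≤1+n with ≤-suc-cases k≤1+n
    ... | inj₁ k≤n  = ≈-trans (≈-reflexive (⊕·X^-below (approx n) _ n k≤n)) (approx≈R n k k≤n)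
    ... | inj₂ refl = ≈-trans (≈-reflexive (⊕·X^-top (approx n) _ n (approx-> (ℕ.n<1+n n))))
                              (nextCoeff-≈ n (approx≈R n))

    approx-square : ∀ n k → k ≤ n → (approx n ⊛ approx n) k ≡ F k
    approx-square zero    zero    _ = sym F0
    approx-square (suc n) k k≤1+n with ≤-suc-cases k≤1+n
    ... | inj₁ k≤n  = trans (⊛-cong-≤ k below below) (approx-square n k k≤n)
      where below : ∀ i → i ≤ k → approx (suc n) i ≡ approx n i
            below i i≤k = ⊕·X^-below (approx n) _ n (ℕ.≤-trans i≤k k≤n)
    ... | inj₂ refl = begin
      (approx (suc n) ⊛ approx (suc n)) (suc n)
        ≡⟨ ⊛-square-approx-⊕·X^ n _ ⟩
      (T ⊛ T) (suc n) + nextCoeff T n * + 2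
        ≡⟨ cong (λ x → (T ⊛ T) (suc n) + x) (half-* (residual-even n (approx≈R n))) ⟩
      (T ⊛ T) (suc n) + (F (suc n) - (T ⊛ T) (suc n))
        ≡⟨ eq ((T ⊛ T) (suc n)) (F (suc n)) ⟩
      F (suc n) ∎
      where
      open ≡-Reasoning
      T : Series
      T = approx n
      eq : ∀ t f → t + (f - t) ≡ f
      eq = solve-∀

    hasIntegralSqrt : HasIntegralSqrt F
    hasIntegralSqrt = √F , refl , λ n →
      trans (⊛-cong-≤ n (agree n) (agree n)) (approx-square n n ℕ.≤-refl)
      where agree : ∀ n k → k ≤ n → √F k ≡ approx n k
            agree n k k≤n = sym (approx-≡-√F k≤n)

squareMod4⇒hasIntegralSqrt : ∀ F → F 0 ≡ 1ℤ → ∀ R → (∀ n → (R ⊛ R) n ≈[ + 4 ] F n) →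
                             HasIntegralSqrt F
squareMod4⇒hasIntegralSqrt F = SquareRoot.hasIntegralSqrt F

negX-sign : ∀ A j → negX A j ≡ (-1ℤ ^ j) * A j
negX-sign A zero          = sym (ℤ.*-identityˡ (A 0))
negX-sign A (suc zero)    = sym (ℤ.-1*i≡-i (A 1))
negX-sign A (suc (suc j)) =
  trans (negX-sign (A ∘ suc ∘ suc) j) (cong (_* A (suc (suc j))) (eq (-1ℤ ^ j)))
  where eq : ∀ x → x ≡ -1ℤ * (-1ℤ * x)
        eq = solve-∀

-1^-≈-mod2 : ∀ j → -1ℤ ^ j ≈[ + 2 ] 1ℤ
-1^-≈-mod2 zero    = ≈-refl
-1^-≈-mod2 (suc j) = ≈-trans (*-cong-≈ (≈-refl {a = -1ℤ}) (-1^-≈-mod2 j)) (≈-intro (divides -1ℤ refl))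

negX-≈-mod2 : ∀ A j → negX A j ≈[ + 2 ] A j
negX-≈-mod2 A j = ≈-trans (≈-reflexive (negX-sign A j)) (odd*-≈-mod2 (A j) (-1^-≈-mod2 j))

⊛-self-2+ : ∀ A d → (A ⊛ A) (2 ℕ.+ d) ≡
                    (A 0 * A (2 ℕ.+ d) + ((A ∘ suc) ⊛ (A ∘ suc)) d) + A (2 ℕ.+ d) * A 0
⊛-self-2+ A d = cong₂ _+_
  (trans (sumTo-suc f d) (cong (λ s → f 0 + s) (sumTo-cong d λ i i≤d →
    cong (λ j → A (suc i) * A j) (ℕ.+-∸-assoc 1 i≤d))))
  (cong (λ j → A (2 ℕ.+ d) * A j) (ℕ.n∸n≡0 (2 ℕ.+ d)))
  where f : ℕ → ℤ
        f i = A i * A (2 ℕ.+ d ∸ i)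

-- The terms i and 2n - i of the Cauchy square cancel in pairs mod 2, leaving the middle one.
⊛-self-double-≈ : ∀ A n → (A ⊛ A) (2 ℕ.* n) ≈[ + 2 ] A n * A n
⊛-self-double-≈ A zero    = ≈-refl
⊛-self-double-≈ A (suc n) =
  subst (λ k → (A ⊛ A) k ≈[ + 2 ] A (suc n) * A (suc n)) (sym (ℕ.*-suc 2 n)) (begin
  (A ⊛ A) (2 ℕ.+ 2 ℕ.* n)          ≡⟨ ⊛-self-2+ A (2 ℕ.* n) ⟩
  (x * y + s) + y * x               ≡⟨ eq x y s ⟩
  s + (x * y) * + 2                 ≈⟨ +-cong-≈ (≈-refl {a = s}) (*-≈0 (x * y)) ⟩
  s + 0ℤ                            ≡⟨ ℤ.+-identityʳ s ⟩
  s                                 ≈⟨ ⊛-self-double-≈ (A ∘ suc) n ⟩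
  A (suc n) * A (suc n)             ∎)
  where
  open ≈-Reasoning (+ 2)
  x y s : ℤ
  x = A 0
  y = A (2 ℕ.+ 2 ℕ.* n)
  s = ((A ∘ suc) ⊛ (A ∘ suc)) (2 ℕ.* n)
  eq : ∀ x y s → (x * y + s) + y * x ≡ s + (x * y) * + 2
  eq = solve-∀

graeffe-≈-mod2 : ∀ A n → graeffe A n ≈[ + 2 ] A n
graeffe-≈-mod2 A n = begin
  graeffe A n          ≈⟨ ⊛-cong-≈ {A = A} (2 ℕ.* n) (λ _ _ → ≈-refl) (λ j _ → negX-≈-mod2 A j) ⟩
  (A ⊛ A) (2 ℕ.* n)    ≈⟨ ⊛-self-double-≈ A n ⟩
  A n * A n            ≈⟨ square-≈-mod2 (A n) ⟩
  A n                  ∎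
  where open ≈-Reasoning (+ 2)

graeffe-cong-mod4 : ∀ A B n → (∀ i → i ≤ 2 ℕ.* n → A i ≈[ + 2 ] B i) →
                    graeffe A n ≈[ + 4 ] graeffe B n
graeffe-cong-mod4 A B n A≈B = subst₂ _≈[ + 4 ]_ (as-weighted A) (as-weighted B)
                                      (⊛-weighted-square-≈ (-1ℤ ^_) -1^-≈-mod2 A B (2 ℕ.* n) A≈B)
  where as-weighted : ∀ A → (A ⊛ ((-1ℤ ^_) ∙ A)) (2 ℕ.* n) ≡ graeffe A n
        as-weighted A = ⊛-cong-≤ {A = A} (2 ℕ.* n) (λ _ _ → refl) (λ j _ → sym (negX-sign A j))

graeffe-0 : ∀ A → A 0 ≡ 1ℤ → graeffe A 0 ≡ 1ℤ
graeffe-0 A A0≡1 = cong (λ a → a * a) A0≡1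

graeffe²-≈-mod4 : ∀ A j → graeffe (graeffe A) j ≈[ + 4 ] graeffe A j
graeffe²-≈-mod4 A j = graeffe-cong-mod4 (graeffe A) A j (λ i _ → graeffe-≈-mod2 A i)

isSquareMod4⇒hasIntegralSqrt : ∀ Q → coeff Q 0 ≡ 1ℤ → IsSquareMod4 Q → HasIntegralSqrt (coeff Q)
isSquareMod4⇒hasIntegralSqrt Q Q0 (R , R²≡Q) =
  squareMod4⇒hasIntegralSqrt (coeff Q) Q0 (coeff R) (λ n → ≈-intro (∣ᵤ⇒∣ (R²≡Q n)))

P₂P₄-hasIntegralSqrt : ∀ P → coeff P 0 ≡ 1ℤ → HasIntegralSqrt (P₂ P ⊛ P₄ P)
P₂P₄-hasIntegralSqrt P P0 =
  squareMod4⇒hasIntegralSqrt (P₂ P ⊛ P₄ P) (cong₂ _*_ P₂0 (graeffe-0 (P₂ P) P₂0)) (P₂ P) λ n →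
    ⊛-cong-≈ {A = P₂ P} n (λ _ _ → ≈-refl) (λ j _ → ≈-sym (graeffe²-≈-mod4 (coeff P) j))
  where P₂0 : P₂ P 0 ≡ 1ℤ
        P₂0 = graeffe-0 (coeff P) P0

proposition2p2 : ((Q : Poly) → coeff Q 0 ≡ + 1 → IsSquareMod4 Q → HasIntegralSqrt (coeff Q))
    × ((P : Poly) → coeff P 0 ≡ + 1 → HasIntegralSqrt (P₂ P ⊛ P₄ P))
proposition2p2 = isSquareMod4⇒hasIntegralSqrt , P₂P₄-hasIntegralSqrt
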